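{- Let $G$ be a finite connected undirected unweighted graph with node set $V$. Algorithm D (described in the context) terminates and outputs the diameter $\mathrm{diam}(G)$, a node $b$ with $e(b)=\mathrm{diam}(G)$, and a diameter certificate $U$ with $|U|\le\pi_{1/3}$, using $O(\pi_{1/3})$ one-to-all distance queries; here, for $\alpha>0$, $\pi_\alpha$ is the maximum size of a packing for the collection $\mathcal{D}_\alpha=\{B(u,\alpha(\mathrm{diam}(G)-e(u))) : u\in V\}$ of open balls. Moreover, $|U|$ is at most $\frac{\pi_{1/3}}{\pi_{[1]}}$ times the minimum size of a diameter certificate of $G$, where $\pi_{[1]}$ is the maximum size of a packing for the collection $\mathcal{D}_{[1]}=\{B[u,\mathrm{diam}(G)-e(u)] : u\in V\}$.
   Context: $d$ is shortest-path distance, $e(u)=\max_v d(u,v)$, $\mathrm{diam}(G)=\max_u e(u)$. $B[u,\rho]=\{v:d(u,v)\le\rho\}$, $B(u,\rho)=\{v:d(u,v)<\rho\}$. A packing for a collection $\mathcal{S}$ of subsets of $V$ is a set $P\subseteq V$ such that every set of $\mathcal{S}$ contains at most one element of $P$. For $U\subseteq V$, $e^U(u)=\min_{x\in U}(d(u,x)+e(x))$ ($=\infty$ if $U=\emptyset$); $U$ is a diameter certificate if $e^U(u)\le\mathrm{diam}(G)$ for all $u\in V$. A one-to-all distance query from $u$ returns $(d(u,v))_{v\in V}$. Algorithm D: maintain $U$ (initially $\emptyset$) with the values $e^U(v)$ for all $v$, and $K$ (initially $\emptyset$) with the eccentricities of its elements. Each iteration: choose $u$ with $e^U(u)$ maximum;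 query distances from $u$, compute $e(u)$, add $u$ to $K$; choose any node $x$ with $d(u,x)+e(x)=e(u)$ (for instance $x=u$; the choice rule is arbitrary); query distances from $x$, compute $e(x)$, add $x$ to $U$ and update $e^U(v):=\min(e^U(v),d(x,v)+e(x))$ for all $v$. After each iteration, if $\max_{w\in K}e(w)\ge\max_{v\in V}e^U(v)$, halt and output $(e(b),b,U)$ where $b\in K$ maximizes $e(b)$; otherwise perform another iteration. -}

module Defs where

open import Data.Nat using (ℕ; zero; suc; _+_; _*_; _∸_; _≤_; _<_; _⊔_; _⊓_)
open import Data.Fin using (Fin)
open import Data.List using (List; foldr; map; allFin)
open import Data.Vec using (lookup)
open import Data.Bool using (if_then_else_)
open import Data.Product using (Σ; _×_; ∃)
open import Data.Sum using (_⊎_)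
open import Relation.Nullary using (¬_)
open import Relation.Binary.PropositionalEquality using (_≡_)
open import Data.Fin.Subset as S using (Subset; _∈_; ∣_∣; ⁅_⁆; _∪_)

Rel : ℕ → Set₁
Rel n = Fin n → Fin n → Set

data Walk {n : ℕ} (Adj : Rel n) : Fin n → Fin n → ℕ → Set where
  here : ∀ {u} → Walk Adj u u 0
  step : ∀ {u w v k} → Adj u w → Walk Adj w v k → Walk Adj u v (suc k)

Symmetric : {n : ℕ} → Rel n → Set
Symmetric Adj = ∀ u v → Adj u v → Adj v u

Connected : {n : ℕ} → Rel n → Set
Connected Adj = ∀ u v → ∃ λ k → Walk Adj u v k

IsDistance : {n : ℕ} → Rel n → (Fin n → Fin n → ℕ) → Set
IsDistance Adj d = ∀ u v → Walk Adj u v (d u v) × (∀ k → Walk Adj u v k → d u v ≤ k)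

maxOver : {n : ℕ} → (Fin n → ℕ) → ℕ
maxOver {n} f = foldr _⊔_ 0 (map f (allFin n))

module Ecc {n : ℕ} (d : Fin n → Fin n → ℕ) where

  ecc : Fin n → ℕ
  ecc u = maxOver (d u)

  diam : ℕ
  diam = maxOver ecc

  -- extended naturals for e^U (∞ when U = ∅)
  data ℕ∞ : Set where
    fin : ℕ → ℕ∞
    ∞   : ℕ∞

  data _≤∞_ : ℕ∞ → ℕ∞ → Set where
    fin≤fin : ∀ {a b} → a ≤ b → fin a ≤∞ fin b
    _≤∞∞    : ∀ x → x ≤∞ ∞

  min∞ : ℕ∞ → ℕ∞ → ℕ∞
  min∞ ∞ y = y
  min∞ x ∞ = x
  min∞ (fin a) (fin b) = fin (a ⊓ b)

  eU : Subset n → Fin n → ℕ∞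
  eU U u = foldr min∞ ∞
    (map (λ x → if lookup U x then fin (d u x + ecc x) else ∞) (allFin n))

  IsCertificate : Subset n → Set
  IsCertificate U = ∀ u → eU U u ≤∞ fin diam

  -- max_{w ∈ K} e(w)  (0 for K = ∅)
  maxK : Subset n → ℕ
  maxK K = maxOver (λ w → if lookup K w then ecc w else 0)

  IsPacking : (Fin n → Fin n → Set) → Subset n → Set
  IsPacking S P = ∀ u p q → p ∈ P → q ∈ P → S u p → S u q → p ≡ q

  IsMaxPacking : (Fin n → Fin n → Set) → ℕ → Set
  IsMaxPacking S k = Σ (Subset n) (λ P → IsPacking S P × ∣ P ∣ ≡ k)
                   × (∀ P → IsPacking S P → ∣ P ∣ ≤ k)

  -- D_{1/3}: open balls B(u, (diam - e(u))/3);  v ∈ iff 3 d(u,v) < diam - e(u)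
  Ball⅓ : Fin n → Fin n → Set
  Ball⅓ u v = 3 * d u v < diam ∸ ecc u

  Ball[1] : Fin n → Fin n → Set
  Ball[1] u v = d u v ≤ diam ∸ ecc u

  -- Algorithm D, as a nondeterministic transition system.
  -- State: (U , K).  One iteration = one Step (two one-to-all queries).

  record State : Set where
    constructor ⟨_,_⟩
    field
      U : Subset n
      K : Subset n
  open State public

  init : State
  init = ⟨ S.⊥ , S.⊥ ⟩

  Step : State → State → Set
  Step s s' = Σ (Fin n) λ u → Σ (Fin n) λ x →
      (∀ v → eU (U s) v ≤∞ eU (U s) u)
    × (d u x + ecc x ≡ ecc u)
    × (s' ≡ ⟨ U s ∪ ⁅ x ⁆ , K s ∪ ⁅ u ⁆ ⟩)

  Halts : State → Set
  Halts s = ∀ v → eU (U s) v ≤∞ fin (maxK (K s))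

  -- Run s m : the algorithm can reach state s after exactly m iterations
  -- (it only continues from a state after ≥ 1 iteration if the test failed).
  data Run : State → ℕ → Set where
    start : Run init 0
    next  : ∀ {s s' m} → Run s m → (m ≡ 0 ⊎ ¬ Halts s) → Step s s' → Run s' (suc m)

-- Each iteration adds to K a node u maximising e^U, together with a node x ∈ U such
-- that d(u,x) + e(x) = e(u); so every p ∈ K stays certified, e^U(p) ≤ e(p), and then
-- e^U(u) ≤ d(u,p) + e(p) for every u.  At a maximiser u, e^U(u) ≥ e^U(v) ≥ e(v) = diam
-- for a peripheral v, hence d(u,p) + e(p) ≥ diam for all p ∈ K.  If some ball
-- B(w, (diam − e(w))/3) contained both u and p, the triangle inequality would give
-- d(u,p) + e(p) ≤ d(w,u) + 2 d(w,p) + e(w) < diam.  So K is a D_{1/3}-packing and at most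
-- π_{1/3} iterations happen.  On halting e^U ≤ max_K e ≤ diam everywhere, which yields the
-- diameter and the certificate.  Finally, for a certificate C and a D_[1]-packing P, each
-- p ∈ P lies in B[x, diam − e(x)] for an x ∈ C attaining e^C(p) ≤ diam, and distinct points
-- of P lie in distinct balls, so π_[1] ≤ |C|.
module Submission where

open import Defs
open import Data.Nat using (ℕ; zero; suc; _+_; _*_; _∸_; _≤_; _<_; _⊔_; z≤n; s≤s; s≤s⁻¹)
open import Data.Nat.Properties
open import Data.Nat.Tactic.RingSolver using (solve-∀)
open import Data.Fin using (Fin; fromℕ<) renaming (zero to fzero; suc to fsuc)
open import Data.List using (foldr; map; allFin)
open import Data.List.Properties using (foldr-preservesᵇ; foldr-preservesᵒ)
open import Data.List.Membership.Propositional.Properties using (foldr-selective; ∈-map⁻)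
import Data.List.Relation.Unary.All.Properties as All
import Data.List.Relation.Unary.Any.Properties as Any
open import Data.Vec using (_∷_; []; lookup)
import Data.Vec as Vec
open import Data.Vec.Properties using ([]=⇒lookup; lookup⇒[]=)
open import Data.Bool using (true; false; if_then_else_)
open import Data.Product using (Σ; _×_; ∃; _,_; proj₁; proj₂)
open import Data.Sum using (_⊎_; inj₁; inj₂; [_,_])
open import Level using (0ℓ)
open import Relation.Nullary using (¬_; yes; no; contradiction)
open import Relation.Binary.Bundles using (TotalPreorder)
open import Relation.Binary.PropositionalEquality
  using (_≡_; _≢_; refl; sym; trans; cong; cong₂; subst; subst₂; isEquivalence)
open import Data.Fin.Subset using (Subset; _∈_; _∉_; _⊆_; ∣_∣; ⁅_⁆; _∪_; _-_; inside; outside)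
open import Data.Fin.Subset.Properties

a+b+b<c : ∀ a b c → 3 * a < c → 3 * b < c → a + b + b < c
a+b+b<c a b c 3a<c 3b<c = *-cancelˡ-< 3 (a + b + b) c
  (subst₂ _<_ (sym (distrib a b)) (triple c) (+-mono-< (+-mono-< 3a<c 3b<c) 3b<c))
  where
  distrib : ∀ a b → 3 * (a + b + b) ≡ 3 * a + 3 * b + 3 * b
  distrib = solve-∀
  triple : ∀ c → c + c + c ≡ 3 * c
  triple = solve-∀

x∉p-x : ∀ {n} (p : Subset n) x → x ∉ p - x
x∉p-x (_ ∷ p) fzero ()
x∉p-x (_ ∷ p) (fsuc x) (Vec.there x∈) = x∉p-x p x x∈

x∈p⇒∣p∣≡1+∣p-x∣ : ∀ {n} {p : Subset n} {x} → x ∈ p → ∣ p ∣ ≡ suc ∣ p - x ∣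
x∈p⇒∣p∣≡1+∣p-x∣ {p = inside ∷ p} Vec.here = cong (λ q → suc ∣ q ∣) (sym (p─⊥≡p p))
x∈p⇒∣p∣≡1+∣p-x∣ {p = inside ∷ p} (Vec.there x∈) = cong suc (x∈p⇒∣p∣≡1+∣p-x∣ x∈)
x∈p⇒∣p∣≡1+∣p-x∣ {p = outside ∷ p} (Vec.there x∈) = x∈p⇒∣p∣≡1+∣p-x∣ x∈

∣p∪q∣≤∣p∣+∣q∣ : ∀ {n} (p q : Subset n) → ∣ p ∪ q ∣ ≤ ∣ p ∣ + ∣ q ∣
∣p∪q∣≤∣p∣+∣q∣ [] [] = z≤n
∣p∪q∣≤∣p∣+∣q∣ (outside ∷ p) (outside ∷ q) = ∣p∪q∣≤∣p∣+∣q∣ p q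
∣p∪q∣≤∣p∣+∣q∣ (outside ∷ p) (inside ∷ q) =
  subst (suc ∣ p ∪ q ∣ ≤_) (sym (+-suc ∣ p ∣ ∣ q ∣)) (s≤s (∣p∪q∣≤∣p∣+∣q∣ p q))
∣p∪q∣≤∣p∣+∣q∣ (inside ∷ p) (outside ∷ q) = s≤s (∣p∪q∣≤∣p∣+∣q∣ p q)
∣p∪q∣≤∣p∣+∣q∣ (inside ∷ p) (inside ∷ q) =
  s≤s (≤-trans (∣p∪q∣≤∣p∣+∣q∣ p q) (+-monoʳ-≤ ∣ p ∣ (n≤1+n ∣ q ∣)))

∣p∪⁅x⁆∣≤1+∣p∣ : ∀ {n} (p : Subset n) x → ∣ p ∪ ⁅ x ⁆ ∣ ≤ suc ∣ p ∣
∣p∪⁅x⁆∣≤1+∣p∣ p x = begin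
  ∣ p ∪ ⁅ x ⁆ ∣     ≤⟨ ∣p∪q∣≤∣p∣+∣q∣ p ⁅ x ⁆ ⟩
  ∣ p ∣ + ∣ ⁅ x ⁆ ∣ ≡⟨ cong (∣ p ∣ +_) (∣⁅x⁆∣≡1 x) ⟩
  ∣ p ∣ + 1         ≡⟨ +-comm ∣ p ∣ 1 ⟩
  suc ∣ p ∣         ∎
  where open ≤-Reasoning

x∉p⇒∣p∣<∣p∪⁅x⁆∣ : ∀ {n} {p : Subset n} {x} → x ∉ p → ∣ p ∣ < ∣ p ∪ ⁅ x ⁆ ∣
x∉p⇒∣p∣<∣p∪⁅x⁆∣ {p = p} {x} x∉p =
  p⊂q⇒∣p∣<∣q∣ (p⊆p∪q ⁅ x ⁆ , x , q⊆p∪q p ⁅ x ⁆ (x∈⁅x⁆ x) , x∉p)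

f≤maxOver : ∀ {n} (f : Fin n → ℕ) v → f v ≤ maxOver f
f≤maxOver {n} f v = foldr-preservesᵒ ≤-⊔ 0 (map f (allFin n))
  (inj₂ (Any.map⁺ (Any.tabulate⁺ v ≤-refl)))
  where
  ≤-⊔ : ∀ x y → f v ≤ x ⊎ f v ≤ y → f v ≤ x ⊔ y
  ≤-⊔ x y = [ (λ le → ≤-trans le (m≤m⊔n x y)) , (λ le → ≤-trans le (m≤n⊔m x y)) ]

maxOver≤ : ∀ {n} (f : Fin n → ℕ) {k} → (∀ v → f v ≤ k) → maxOver f ≤ k
maxOver≤ f {k} bound = foldr-preservesᵇ {P = _≤ k} ⊔-lub z≤n (All.map⁺ (All.tabulate⁺ bound))

maxOver-attained : ∀ {n} (f : Fin n → ℕ) → 0 < n → ∃ λ v → f v ≡ maxOver f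
maxOver-attained {n} f 0<n with foldr-selective ⊔-sel 0 (map f (allFin n))
... | inj₂ max∈ with ∈-map⁻ f max∈
...   | v , _ , max≡fv = v , sym max≡fv
maxOver-attained {n} f 0<n | inj₁ max≡0 = v , trans fv≡0 (sym max≡0)
  where
  v = fromℕ< 0<n
  fv≡0 : f v ≡ 0
  fv≡0 = n≤0⇒n≡0 (subst (f v ≤_) max≡0 (f≤maxOver f v))

module _ {a ℓ₁ ℓ₂} (O : TotalPreorder a ℓ₁ ℓ₂) where
  open TotalPreorder O using (Carrier; _≲_; total) renaming (refl to ≲-refl; trans to ≲-trans)

  argmax : ∀ {k} → 0 < k → (g : Fin k → Carrier) → ∃ λ u → ∀ v → g v ≲ g u
  argmax {suc zero} _ g = fzero , λ { fzero → ≲-refl }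
  argmax {suc (suc k)} _ g with argmax (s≤s z≤n) (λ v → g (fsuc v))
  ... | u , max with total (g fzero) (g (fsuc u))
  ...   | inj₁ g0≲gu = fsuc u , λ { fzero → g0≲gu ; (fsuc v) → max v }
  ...   | inj₂ gu≲g0 = fzero , λ { fzero → ≲-refl ; (fsuc v) → ≲-trans (max v) gu≲g0 }

-- Shortest-path distances form a pseudometric

record IsPseudometric {n : ℕ} (d : Fin n → Fin n → ℕ) : Set where
  field
    d-diag     : ∀ u → d u u ≡ 0
    d-sym      : ∀ u v → d u v ≡ d v u
    d-triangle : ∀ u v w → d u w ≤ d u v + d v w

module _ {n : ℕ} {Adj : Rel n} where

  _++ʷ_ : ∀ {u v w k j} → Walk Adj u v k → Walk Adj v w j → Walk Adj u w (k + j)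
  here ++ʷ q = q
  step e p ++ʷ q = step e (p ++ʷ q)

  reverse-onto : Symmetric Adj → ∀ {u v w k j} →
                 Walk Adj u v k → Walk Adj u w j → Walk Adj v w (k + j)
  reverse-onto sym here q = q
  reverse-onto sym {k = suc k} {j} (step e p) q =
    subst (Walk Adj _ _) (+-suc k j) (reverse-onto sym p (step (sym _ _ e) q))

  IsDistance⇒IsPseudometric : Symmetric Adj → ∀ {d} → IsDistance Adj d → IsPseudometric d
  IsDistance⇒IsPseudometric symAdj {d} isD = record
    { d-diag     = λ u → n≤0⇒n≡0 (shortest u u here)
    ; d-sym      = λ u v → ≤-antisym (d-sym≤ u v) (d-sym≤ v u)
    ; d-triangle = λ u v w → shortest u w (geodesic u v ++ʷ geodesic v w)
    }
    where
    geodesic : ∀ u v → Walk Adj u v (d u v)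
    geodesic u v = proj₁ (isD u v)
    shortest : ∀ u v {k} → Walk Adj u v k → d u v ≤ k
    shortest u v = proj₂ (isD u v) _
    d-sym≤ : ∀ u v → d u v ≤ d v u
    d-sym≤ u v = shortest u v
      (subst (Walk Adj u v) (+-identityʳ _) (reverse-onto symAdj (geodesic v u) here))

-- Eccentricities, e^U and packings, for an arbitrary distance function

module Eccentricities {n : ℕ} (d : Fin n → Fin n → ℕ) where
  open Ecc d

  ≤∞-refl : ∀ {a} → a ≤∞ a
  ≤∞-refl {fin a} = fin≤fin ≤-refl
  ≤∞-refl {∞} = ∞ ≤∞∞

  ≤∞-trans : ∀ {a b c} → a ≤∞ b → b ≤∞ c → a ≤∞ c
  ≤∞-trans (fin≤fin a≤b) (fin≤fin b≤c) = fin≤fin (≤-trans a≤b b≤c)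
  ≤∞-trans _ (_ ≤∞∞) = _ ≤∞∞

  ≤∞-total : ∀ a b → a ≤∞ b ⊎ b ≤∞ a
  ≤∞-total (fin a) (fin b) = Data.Sum.map fin≤fin fin≤fin (≤-total a b)
  ≤∞-total a ∞ = inj₁ (a ≤∞∞)
  ≤∞-total ∞ (fin b) = inj₂ (fin b ≤∞∞)

  ≤∞-totalPreorder : TotalPreorder 0ℓ 0ℓ 0ℓ
  ≤∞-totalPreorder = record
    { Carrier = ℕ∞ ; _≈_ = _≡_ ; _≲_ = _≤∞_
    ; isTotalPreorder = record
      { isPreorder = record
        { isEquivalence = isEquivalence
        ; reflexive = λ { refl → ≤∞-refl }
        ; trans = ≤∞-trans }
      ; total = ≤∞-total } }

  fin≤fin⁻¹ : ∀ {a b} → fin a ≤∞ fin b → a ≤ b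
  fin≤fin⁻¹ (fin≤fin a≤b) = a≤b

  min∞-sel : ∀ a b → min∞ a b ≡ a ⊎ min∞ a b ≡ b
  min∞-sel ∞ b = inj₂ refl
  min∞-sel (fin a) ∞ = inj₁ refl
  min∞-sel (fin a) (fin b) = Data.Sum.map (cong fin) (cong fin) (⊓-sel a b)

  min∞-glb : ∀ {c} a b → c ≤∞ a → c ≤∞ b → c ≤∞ min∞ a b
  min∞-glb ∞ b _ c≤b = c≤b
  min∞-glb (fin a) ∞ c≤a _ = c≤a
  min∞-glb (fin a) (fin b) (fin≤fin c≤a) (fin≤fin c≤b) = fin≤fin (⊓-glb c≤a c≤b)

  min∞-≤ˡ : ∀ a b → min∞ a b ≤∞ a
  min∞-≤ˡ ∞ b = b ≤∞∞
  min∞-≤ˡ (fin a) ∞ = ≤∞-refl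
  min∞-≤ˡ (fin a) (fin b) = fin≤fin (m⊓n≤m a b)

  min∞-≤ʳ : ∀ a b → min∞ a b ≤∞ b
  min∞-≤ʳ ∞ b = ≤∞-refl
  min∞-≤ʳ (fin a) ∞ = fin a ≤∞∞
  min∞-≤ʳ (fin a) (fin b) = fin≤fin (m⊓n≤n a b)

  diam-attained : 0 < n → ∃ λ v → ecc v ≡ diam
  diam-attained = maxOver-attained ecc

  d≤ecc : ∀ u v → d u v ≤ ecc u
  d≤ecc u = f≤maxOver (d u)

  ecc≤diam : ∀ u → ecc u ≤ diam
  ecc≤diam = f≤maxOver ecc

  eU-term : Subset n → Fin n → Fin n → ℕ∞
  eU-term U u x = if lookup U x then fin (d u x + ecc x) else ∞

  eU-upper : ∀ U v {x} → x ∈ U → eU U v ≤∞ fin (d v x + ecc x)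
  eU-upper U v {x} x∈U = foldr-preservesᵒ min∞-≤ ∞ (map (eU-term U v) (allFin n))
    (inj₂ (Any.map⁺ (Any.tabulate⁺ x term≤)))
    where
    min∞-≤ : ∀ a b → a ≤∞ fin _ ⊎ b ≤∞ fin _ → min∞ a b ≤∞ fin _
    min∞-≤ a b = [ ≤∞-trans (min∞-≤ˡ a b) , ≤∞-trans (min∞-≤ʳ a b) ]
    term≤ : eU-term U v x ≤∞ fin (d v x + ecc x)
    term≤ rewrite []=⇒lookup x∈U = ≤∞-refl

  eU-witness : ∀ U v {k} → eU U v ≤∞ fin k → ∃ λ x → x ∈ U × d v x + ecc x ≤ k
  eU-witness U v eU≤k with foldr-selective (min∞-sel) ∞ (map (eU-term U v) (allFin n))
  ... | inj₁ eU≡∞ with () ← subst (_≤∞ _) eU≡∞ eU≤k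
  ... | inj₂ eU∈ with ∈-map⁻ (eU-term U v) eU∈
  ...   | x , _ , eU≡term = x , term-witness (subst (_≤∞ _) eU≡term eU≤k)
    where
    term-witness : ∀ {k} → eU-term U v x ≤∞ fin k → x ∈ U × d v x + ecc x ≤ k
    term-witness term≤k with lookup U x in x∈U
    term-witness (fin≤fin le) | true = lookup⇒[]= x U x∈U , le

  eU-mono : ∀ U U′ v {k} → U ⊆ U′ → eU U v ≤∞ fin k → eU U′ v ≤∞ fin k
  eU-mono U U′ v U⊆U′ eU≤k with eU-witness U v eU≤k
  ... | x , x∈U , le = ≤∞-trans (eU-upper U′ v (U⊆U′ x∈U)) (fin≤fin le)

  ecc≤maxK : ∀ {Ks w} → w ∈ Ks → ecc w ≤ maxK Ks
  ecc≤maxK {Ks} {w} w∈Ks with f≤maxOver (λ w → if lookup Ks w then ecc w else 0) w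
  ... | le rewrite []=⇒lookup w∈Ks = le

  maxK≤ : ∀ Ks {c} → (∀ w → w ∈ Ks → ecc w ≤ c) → maxK Ks ≤ c
  maxK≤ Ks {c} bound = maxOver≤ _ entry≤
    where
    entry≤ : ∀ w → (if lookup Ks w then ecc w else 0) ≤ c
    entry≤ w with lookup Ks w in w∈Ks
    ... | true  = bound w (lookup⇒[]= w Ks w∈Ks)
    ... | false = z≤n

  Maximiser : Subset n → Fin n → Set
  Maximiser U u = ∀ v → eU U v ≤∞ eU U u

  maximiser-exists : 0 < n → ∀ U → ∃ (Maximiser U)
  maximiser-exists 0<n U = argmax ≤∞-totalPreorder 0<n (eU U)

  packing-∪⁅⁆ : ∀ {S P u} → IsPacking S P → (∀ w p → p ∈ P → S w u → ¬ S w p) →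
                IsPacking S (P ∪ ⁅ u ⁆)
  packing-∪⁅⁆ {S} {P} {u} packing apart w p q p∈ q∈ Swp Swq
    with x∈p∪q⁻ P ⁅ u ⁆ p∈ | x∈p∪q⁻ P ⁅ u ⁆ q∈
  ... | inj₁ p∈P | inj₁ q∈P = packing w p q p∈P q∈P Swp Swq
  ... | inj₁ p∈P | inj₂ q∈⁅u⁆ rewrite x∈⁅y⁆⇒x≡y u q∈⁅u⁆ = contradiction Swp (apart w p p∈P Swq)
  ... | inj₂ p∈⁅u⁆ | inj₁ q∈P rewrite x∈⁅y⁆⇒x≡y u p∈⁅u⁆ = contradiction Swq (apart w q q∈P Swp)
  ... | inj₂ p∈⁅u⁆ | inj₂ q∈⁅u⁆ = trans (x∈⁅y⁆⇒x≡y u p∈⁅u⁆) (sym (x∈⁅y⁆⇒x≡y u q∈⁅u⁆))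

  packing≤cover : ∀ {S P C} → IsPacking S P → (∀ p → p ∈ P → ∃ λ x → x ∈ C × S x p) →
                  ∣ P ∣ ≤ ∣ C ∣
  packing≤cover {S} {P} = bounded ∣ P ∣ ≤-refl
    where
    bounded : ∀ k {P C} → ∣ P ∣ ≤ k → IsPacking S P →
              (∀ p → p ∈ P → ∃ λ x → x ∈ C × S x p) → ∣ P ∣ ≤ ∣ C ∣
    bounded zero ∣P∣≤0 _ _ = ≤-trans ∣P∣≤0 z≤n
    bounded (suc k) {P} {C} ∣P∣≤1+k packing cover with nonempty? P
    ... | no P-empty =
      subst (_≤ ∣ C ∣) (sym (trans (cong ∣_∣ (Empty-unique P-empty)) (∣⊥∣≡0 n))) z≤n
    ... | yes (p , p∈P) with cover p p∈P
    ...   | x , x∈C , Sxp = begin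
      ∣ P ∣           ≡⟨ x∈p⇒∣p∣≡1+∣p-x∣ p∈P ⟩
      suc ∣ P - p ∣   ≤⟨ s≤s (bounded k ∣P-p∣≤k packing-p cover-p) ⟩
      suc ∣ C - x ∣   ≡⟨ sym (x∈p⇒∣p∣≡1+∣p-x∣ x∈C) ⟩
      ∣ C ∣           ∎
      where
      open ≤-Reasoning
      ∣P-p∣≤k : ∣ P - p ∣ ≤ k
      ∣P-p∣≤k = s≤s⁻¹ (subst (_≤ suc k) (x∈p⇒∣p∣≡1+∣p-x∣ p∈P) ∣P∣≤1+k)
      P-p⊆P : P - p ⊆ P
      P-p⊆P = p─q⊆p P ⁅ p ⁆
      packing-p : IsPacking S (P - p)
      packing-p w q r q∈ r∈ = packing w q r (P-p⊆P q∈) (P-p⊆P r∈)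
      cover-p : ∀ q → q ∈ P - p → ∃ λ y → y ∈ C - x × S y q
      cover-p q q∈ with cover q (P-p⊆P q∈)
      ... | y , y∈C , Syq = y , x∈p∧x≢y⇒x∈p-y y∈C y≢x , Syq
        where
        y≢x : y ≢ x
        y≢x refl = x∉p-x P p (subst (_∈ P - p) (packing x q p (P-p⊆P q∈) p∈P Syq Sxp) q∈)

  module AlgorithmD (metric : IsPseudometric d) (0<n : 0 < n) where
    open IsPseudometric metric

    ecc-triangle : ∀ u v → ecc u ≤ d u v + ecc v
    ecc-triangle u v = maxOver≤ (d u) λ w →
      ≤-trans (d-triangle u v w) (+-monoʳ-≤ (d u v) (d≤ecc v w))

    eU-lower : ∀ U v → fin (ecc v) ≤∞ eU U v
    eU-lower U v = foldr-preservesᵇ (λ {a} {b} → min∞-glb a b) (_ ≤∞∞)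
      (All.map⁺ (All.tabulate⁺ {P = λ x → fin (ecc v) ≤∞ eU-term U v x} term≥))
      where
      term≥ : ∀ x → fin (ecc v) ≤∞ eU-term U v x
      term≥ x with lookup U x
      ... | true  = fin≤fin (ecc-triangle v x)
      ... | false = _ ≤∞∞

    eU-lipschitz : ∀ U u p {k} → eU U p ≤∞ fin k → eU U u ≤∞ fin (d u p + k)
    eU-lipschitz U u p {k} eU≤k with eU-witness U p eU≤k
    ... | x , x∈U , dpx+ex≤k = ≤∞-trans (eU-upper U u x∈U) (fin≤fin (begin
      d u x + ecc x         ≤⟨ +-monoˡ-≤ (ecc x) (d-triangle u p x) ⟩
      d u p + d p x + ecc x ≡⟨ +-assoc (d u p) (d p x) (ecc x) ⟩
      d u p + (d p x + ecc x) ≤⟨ +-monoʳ-≤ (d u p) dpx+ex≤k ⟩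
      d u p + k             ∎))
      where open ≤-Reasoning

    maximiser-eU≥diam : ∀ U {u} → Maximiser U u → fin diam ≤∞ eU U u
    maximiser-eU≥diam U max with diam-attained 0<n
    ... | v , ev≡diam = subst (λ e → fin e ≤∞ _) ev≡diam (≤∞-trans (eU-lower U v) (max v))

    d+ecc≤via-centre : ∀ w u p → d u p + ecc p ≤ d w u + d w p + d w p + ecc w
    d+ecc≤via-centre w u p = begin
      d u p + ecc p                     ≤⟨ +-mono-≤ (d-triangle u w p) (ecc-triangle p w) ⟩
      d u w + d w p + (d p w + ecc w)   ≡⟨ cong₂ (λ a b → a + d w p + (b + ecc w))
                                              (d-sym u w) (d-sym p w) ⟩
      d w u + d w p + (d w p + ecc w)   ≡⟨ +-assoc (d w u + d w p) (d w p) (ecc w) ⟨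
      d w u + d w p + d w p + ecc w     ∎
      where open ≤-Reasoning

    Ball⅓-pair : ∀ {w u p} → Ball⅓ w u → Ball⅓ w p → d w u + d w p + d w p + ecc w < diam
    Ball⅓-pair {w} {u} {p} wu wp =
      m≤o∸n⇒m+n≤o (suc (d w u + d w p + d w p)) (ecc≤diam w) (a+b+b<c (d w u) (d w p) _ wu wp)

    maximiser-apart : ∀ U {u p} → Maximiser U u → eU U p ≤∞ fin (ecc p) →
                      ∀ w → Ball⅓ w u → ¬ Ball⅓ w p
    maximiser-apart U {u} {p} max p-certified w wu wp = <⇒≱ (begin-strict
      d u p + ecc p                     ≤⟨ d+ecc≤via-centre w u p ⟩
      d w u + d w p + d w p + ecc w     <⟨ Ball⅓-pair wu wp ⟩
      diam                              ∎)
      (fin≤fin⁻¹ (≤∞-trans (maximiser-eU≥diam U max) (eU-lipschitz U u p p-certified)))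
      where open ≤-Reasoning

    record Invariant (s : State) (m : ℕ) : Set where
      field
        iterations≤∣K∣ : m ≤ ∣ K s ∣
        ∣U∣≤iterations : ∣ U s ∣ ≤ m
        K-certified    : ∀ {p} → p ∈ K s → eU (U s) p ≤∞ fin (ecc p)
        K-packing      : IsPacking Ball⅓ (K s)
    open Invariant

    invariant-init : Invariant init 0
    invariant-init = record
      { iterations≤∣K∣ = z≤n
      ; ∣U∣≤iterations = ≤-reflexive (∣⊥∣≡0 n)
      ; K-certified    = λ p∈⊥ → contradiction p∈⊥ ∉⊥
      ; K-packing      = λ _ _ _ p∈⊥ _ → contradiction p∈⊥ ∉⊥
      }

    invariant-step : ∀ {s m u x} → Invariant s m → u ∉ K s → Maximiser (U s) u →
                     d u x + ecc x ≡ ecc u → Invariant ⟨ U s ∪ ⁅ x ⁆ , K s ∪ ⁅ u ⁆ ⟩ (suc m)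
    invariant-step {s} {m} {u} {x} I u∉K max witness = record
      { iterations≤∣K∣ = ≤-trans (s≤s (iterations≤∣K∣ I)) (x∉p⇒∣p∣<∣p∪⁅x⁆∣ u∉K)
      ; ∣U∣≤iterations = ≤-trans (∣p∪⁅x⁆∣≤1+∣p∣ (U s) x) (s≤s (∣U∣≤iterations I))
      ; K-certified    = certified
      ; K-packing      = packing-∪⁅⁆ (K-packing I) λ w p p∈K →
                           maximiser-apart (U s) max (K-certified I p∈K) w
      }
      where
      certified : ∀ {p} → p ∈ K s ∪ ⁅ u ⁆ → eU (U s ∪ ⁅ x ⁆) p ≤∞ fin (ecc p)
      certified {p} p∈ with x∈p∪q⁻ (K s) ⁅ u ⁆ p∈
      ... | inj₁ p∈K = eU-mono (U s) (U s ∪ ⁅ x ⁆) p (p⊆p∪q ⁅ x ⁆) (K-certified I p∈K)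
      ... | inj₂ p∈⁅u⁆ rewrite x∈⁅y⁆⇒x≡y u p∈⁅u⁆ =
        subst (λ e → eU (U s ∪ ⁅ x ⁆) u ≤∞ fin e) witness
          (eU-upper (U s ∪ ⁅ x ⁆) u (q⊆p∪q (U s) ⁅ x ⁆ (x∈⁅x⁆ x)))

    maximiser∈K⇒halts : ∀ {s m u} → Invariant s m → Maximiser (U s) u → u ∈ K s → Halts s
    maximiser∈K⇒halts I max u∈K v =
      ≤∞-trans (max v) (≤∞-trans (K-certified I u∈K) (fin≤fin (ecc≤maxK u∈K)))

    maximiser∉K : ∀ {s m u} → Run s m → (m ≡ 0 ⊎ ¬ Halts s) → Invariant s m →
                  Maximiser (U s) u → u ∉ K s
    maximiser∉K start _ _ _ = ∉⊥
    maximiser∉K (next _ _ _) (inj₂ running) I max u∈K = running (maximiser∈K⇒halts I max u∈K)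

    invariant : ∀ {s m} → Run s m → Invariant s m
    invariant start = invariant-init
    invariant (next r continue (u , x , max , witness , refl)) =
      invariant-step I (maximiser∉K r continue I max) max witness
      where I = invariant r

    step-exists : ∀ s → Σ State (Step s)
    step-exists s with maximiser-exists 0<n (U s)
    ... | u , max = _ , u , u , max , cong (_+ ecc u) (d-diag u) , refl

    halts⇒ecc≡diam : ∀ s → Halts s →
                     ∀ b → b ∈ K s → (∀ w → w ∈ K s → ecc w ≤ ecc b) → ecc b ≡ diam
    halts⇒ecc≡diam s halts b b∈K b-max = ≤-antisym (ecc≤diam b) (maxOver≤ ecc λ v →
      ≤-trans (fin≤fin⁻¹ (≤∞-trans (eU-lower (U s) v) (halts v))) (maxK≤ (K s) b-max))

    halts⇒certificate : ∀ s → Halts s → IsCertificate (U s)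
    halts⇒certificate s halts v =
      ≤∞-trans (halts v) (fin≤fin (maxK≤ (K s) λ w _ → ecc≤diam w))

    Ball[1]-packing≤certificate : ∀ P C → IsPacking Ball[1] P → IsCertificate C → ∣ P ∣ ≤ ∣ C ∣
    Ball[1]-packing≤certificate P C packing certificate = packing≤cover packing λ p _ →
      let x , x∈C , dpx+ex≤diam = eU-witness C p (certificate p) in
      x , x∈C , subst (_≤ diam ∸ ecc x) (d-sym p x) (m+n≤o⇒m≤o∸n (d p x) dpx+ex≤diam)

    iterations≤π⅓ : ∀ {π⅓} → IsMaxPacking Ball⅓ π⅓ → ∀ {s m} → Run s m → m ≤ π⅓
    iterations≤π⅓ (_ , maximal) {s} r = ≤-trans (iterations≤∣K∣ I) (maximal (K s) (K-packing I))
      where I = invariant r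

    ∣U∣≤π⅓ : ∀ {π⅓} → IsMaxPacking Ball⅓ π⅓ → ∀ {s m} → Run s m → ∣ U s ∣ ≤ π⅓
    ∣U∣≤π⅓ max⅓ r = ≤-trans (∣U∣≤iterations (invariant r)) (iterations≤π⅓ max⅓ r)

theorem4 : ∃ λ (c : ℕ) →
    ∀ (n : ℕ) → 0 < n → (Adj : Rel n) → Symmetric Adj → Connected Adj →
    (d : Fin n → Fin n → ℕ) → IsDistance Adj d →
    let open Ecc d in
    (π⅓ π[1] : ℕ) → IsMaxPacking Ball⅓ π⅓ → IsMaxPacking Ball[1] π[1] →
      (∀ s m → Run s m → (m ≡ 0 ⊎ ¬ Halts s) → Σ State λ s' → Step s s')
    × (∀ s m → Run s m → 2 * m ≤ c * π⅓)
    × (∀ s m → Run s m → 1 ≤ m → Halts s →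
          (∀ b → b ∈ K s → (∀ w → w ∈ K s → ecc w ≤ ecc b) → ecc b ≡ diam)
        × IsCertificate (U s)
        × ∣ U s ∣ ≤ π⅓
        × (∀ C → IsCertificate C → ∣ U s ∣ * π[1] ≤ π⅓ * ∣ C ∣))
theorem4 = 2 , λ where
  n 0<n Adj symAdj _ d isD π⅓ π[1] max⅓ ((P , P-packing , ∣P∣≡π[1]) , _) →
    let open Eccentricities.AlgorithmD d (IsDistance⇒IsPseudometric symAdj isD) 0<n in
      (λ s _ _ _ → step-exists s)
    , (λ s m r → *-monoʳ-≤ 2 (iterations≤π⅓ max⅓ r))
    , λ s m r _ halts →
        halts⇒ecc≡diam s halts
      , halts⇒certificate s halts
      , ∣U∣≤π⅓ max⅓ r
      , λ C certificate → *-mono-≤ (∣U∣≤π⅓ max⅓ r)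
          (subst (_≤ ∣ C ∣) ∣P∣≡π[1] (Ball[1]-packing≤certificate P C P-packing certificate))
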